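{- Let $n\ge 2$ be an integer and $\delta>0$. Let $G$ be a bipartite graph on $2n$ vertices of maximum degree $d$ which is a $\delta$-expander, and let $e$ be an edge of $G$. Assume that $G$ admits a perfect matching. Then \[p(e)\ge \frac1d\, n^{ -2\ln(d-1)/\ln(1+\delta)}.\]
   Context: A bipartite graph $G=(U,V,E)$ with vertex classes $U,V$ is a $\delta$-expander if $|N(U')|\ge(1+\delta)|U'|$ for every $U'\subseteq U$ with $|U'|\le |U|/2$, and $|N(V')|\ge (1+\delta)|V'|$ for every $V'\subseteq V$ with $|V'|\le |V|/2$, where $N(\cdot)$ denotes the set of neighbours. For a graph admitting a perfect matching and an edge $e$, $p(e)$ is the probability that $e$ belongs to a uniformly random perfect matching of the graph.
   Formalization: The expansion parameter δ ranges over the positive rationals. -}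

module Defs where

open import Data.Nat using (ℕ; zero; suc; _+_; _*_)
open import Data.Bool using (Bool; true; false; _∧_; not; T?)
open import Data.Fin using (Fin)
open import Data.Fin.Properties using (_≟_)
open import Data.List using (List; []; _∷_; map; concatMap; filter; length)
open import Data.Vec using (Vec; []; _∷_; lookup; tabulate; allFin)
import Data.Vec as Vec
open import Data.Fin.Subset using (Subset)
open import Relation.Nullary.Decidable using (⌊_⌋)
open import Relation.Binary.PropositionalEquality using (_≡_)

-- A bipartite graph with vertex classes U = Fin n and V = Fin n,
-- given by its biadjacency relation: Adj G i j = true iff u_i ~ v_j.
record BipGraph (n : ℕ) : Set where
  field
    Adj : Fin n → Fin n → Bool
open BipGraph public

anyFin : ∀ {n} → (Fin n → Bool) → Bool
anyFin {n} p = Vec.foldr _ (λ b acc → b Data.Bool.∨ acc) false (tabulate p)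

allFin? : ∀ {n} → (Fin n → Bool) → Bool
allFin? {n} p = Vec.foldr _ _∧_ true (tabulate p)

countFin : ∀ {n} → (Fin n → Bool) → ℕ
countFin {n} p = Vec.foldr _ (λ b acc → (if b then 1 else 0) + acc) 0 (tabulate p)
  where open import Data.Bool using (if_then_else_)

degU : ∀ {n} → BipGraph n → Fin n → ℕ
degU G i = countFin (λ j → Adj G i j)

degV : ∀ {n} → BipGraph n → Fin n → ℕ
degV G j = countFin (λ i → Adj G i j)

MaxDegree : ∀ {n} → BipGraph n → ℕ → Set
MaxDegree {n} G d =
  ((i : Fin n) → degU G i Data.Nat.≤ d) ×
  ((j : Fin n) → degV G j Data.Nat.≤ d) ×
  ((Σ (Fin n) λ i → degU G i ≡ d) ⊎ (Σ (Fin n) λ j → degV G j ≡ d))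
  where open import Data.Product using (_×_; Σ)
        open import Data.Sum using (_⊎_)

NU : ∀ {n} → BipGraph n → Subset n → Subset n
NU G S = tabulate λ j → anyFin λ i → lookup S i ∧ Adj G i j

NV : ∀ {n} → BipGraph n → Subset n → Subset n
NV G T = tabulate λ i → anyFin λ j → lookup T j ∧ Adj G i j

-- δ-expander with rational δ = u / v  (v ≠ 0):
-- |N(S)| ≥ (1 + u/v) |S|  written  (v + u) * |S| ≤ v * |N(S)|,
-- for all S with |S| ≤ n/2, i.e. 2 * |S| ≤ n, on both sides.
IsExpander : ∀ {n} → BipGraph n → (u v : ℕ) → Set
IsExpander {n} G u v =
  ((S : Subset n) → 2 * ∣ S ∣ Data.Nat.≤ n → (v + u) * ∣ S ∣ Data.Nat.≤ v * ∣ NU G S ∣) ×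
  ((T : Subset n) → 2 * ∣ T ∣ Data.Nat.≤ n → (v + u) * ∣ T ∣ Data.Nat.≤ v * ∣ NV G T ∣)
  where open import Data.Product using (_×_)
        open import Data.Fin.Subset using (∣_∣)

-- A perfect matching is a vector σ with σ[i] the partner of u_i:
-- all pairs (i, σ i) are edges, and σ is injective.
IsPerfectMatching : ∀ {n} → BipGraph n → Vec (Fin n) n → Bool
IsPerfectMatching G σ =
  allFin? (λ i → Adj G i (lookup σ i)) ∧
  allFin? (λ i → allFin? (λ k → ⌊ i ≟ k ⌋ Data.Bool.∨ not ⌊ lookup σ i ≟ lookup σ k ⌋))

allVecs : (n k : ℕ) → List (Vec (Fin n) k)
allVecs n zero = [] ∷ []
allVecs n (suc k) =
  concatMap (λ x → map (x ∷_) (allVecs n k)) (Data.List.tabulate {n = n} (λ x → x))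

perfectMatchings : ∀ {n} → BipGraph n → List (Vec (Fin n) n)
perfectMatchings {n} G = filter (λ σ → T? (IsPerfectMatching G σ)) (allVecs n n)

numPM : ∀ {n} → BipGraph n → ℕ
numPM G = length (perfectMatchings G)

numPMThrough : ∀ {n} → BipGraph n → Fin n → Fin n → ℕ
numPMThrough G i j =
  length (filter (λ σ → lookup σ i ≟ j) (perfectMatchings G))

{-# OPTIONS --safe #-}
module Submission where

-- Let σ be a perfect matching avoiding e = u_i v_j and let i′ be the partner of v_j.  A cycle
-- i, i′, x₁, …, x_k in U in which each vertex is adjacent to the partner of the next one is an
-- alternating cycle through e, and moving every vertex to the partner of its successor gives a
-- perfect matching containing e.  Expansion lets the sets of vertices reachable forwards from i′
-- and backwards from i by such steps grow by the factor 1 + δ until they exceed n/2, so they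
-- meet, and a shortest cycle has m vertices with (1 + δ)^(m - 1) ≤ n².  Knowing the new matching,
-- the cycle is recovered from i by choosing, at each vertex, one of at most d - 1 other neighbours
-- of its new partner.  Hence p(e)⁻¹ ≤ 1 + (d - 1)^(J + 1) for the largest admissible J, and
-- (d - 1)^J ≤ n^(2a/b) whenever (d - 1)^b ≤ (1 + δ)^a.

open import Defs
open import Data.Nat using (ℕ; zero; suc; _+_; _*_; _∸_; _^_; _≤_; _<_; z≤n; s≤s; >-nonZero)
open import Data.Nat.Properties
  using (_≤?_; ≤-refl; ≤-trans; ≤-reflexive; ≤-antisym; <-≤-trans; ≤-<-trans; ≤-pred; ≤⇒≯; <⇒≱; ≰⇒>;
         n≮n; m≤n⇒m≤1+n; m≤n⇒m<n∨m≡n; m<m+n; m+[n∸m]≡n; ∸-monoˡ-≤;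
         +-identityʳ; +-suc; +-mono-≤; +-monoˡ-≤; +-mono-<;
         *-identityˡ; *-identityʳ; *-zeroʳ; *-assoc; *-comm; *-distribˡ-+; [m*n]*[o*p]≡[m*o]*[n*p];
         *-mono-≤; *-monoʳ-≤; *-monoˡ-<; *-cancelˡ-<; *-cancelʳ-≤;
         ^-zeroˡ; ^-distribˡ-+-*; ^-*-assoc; ^-monoˡ-≤; m^n>0; module ≤-Reasoning)
open import Data.Bool using (Bool; true; false; _∧_; _∨_; not; T?)
import Data.Bool as Bool
open import Data.Bool.Properties using (T-≡; ∨-identityʳ)
open import Data.Fin using (Fin; zero; suc; toℕ; punchOut)
open import Data.Fin.Properties using (_≟_; toℕ<n; any?; punchOut-injective; injective⇒≤)
open import Data.Fin.Permutation as Perm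
  using (Permutation′; permutation; _⟨$⟩ʳ_; _⟨$⟩ˡ_; inverseˡ; inverseʳ; _∘ₚ_; transpose)
open import Data.Fin.Subset using (∣_∣)
open import Data.Vec using (Vec; []; _∷_; tabulate; lookup)
import Data.Vec as Vec
open import Data.Vec.Properties using (∷-injective; lookup∘tabulate; tabulate∘lookup; tabulate-cong)
import Data.Vec.Relation.Unary.All as VecAll
open import Data.List
  using (List; []; _∷_; _++_; length; map; concatMap; cartesianProductWith; filter; filterᵇ; upTo)
import Data.List as List
open import Data.List.Properties using (length-++; length-map; length-removeAt′; length-tabulate; length-upTo)
open import Data.List.Relation.Unary.Any using (here; there; _─_)
import Data.List.Relation.Unary.Any as Any
open import Data.List.Relation.Unary.All using (All; []; _∷_)
import Data.List.Relation.Unary.All as All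
import Data.List.Relation.Unary.AllPairs as AllPairs
open import Data.List.Relation.Unary.Unique.Propositional using (Unique; []; _∷_)
import Data.List.Relation.Unary.Unique.Propositional.Properties as Uniqueₚ
open import Data.List.Relation.Binary.Disjoint.Propositional using (Disjoint)
open import Data.List.Relation.Binary.Subset.Propositional using (_⊆_)
open import Data.List.Membership.Propositional using (_∈_; _∉_)
open import Data.List.Membership.Propositional.Properties
  using (∈-map⁻; ∈-++⁺ˡ; ∈-++⁺ʳ; ∈-filter⁺; ∈-filter⁻; ∈-allFin; ∈-upTo⁺; ∈-cartesianProductWith⁺)
open import Data.Maybe using (Maybe; just; nothing)
open import Data.Product using (Σ; ∃; _×_; _,_; proj₁; proj₂)
open import Data.Sum using (_⊎_; inj₁; inj₂)
open import Data.Empty using (⊥-elim)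
open import Function using (id; _∘_; case_of_)
open import Function.Bundles using (Equivalence)
open import Function.Definitions using (Injective)
open import Relation.Nullary using (Dec; yes; no; ¬_; contradiction)
open import Relation.Nullary.Decidable using (⌊_⌋; dec-true)
open import Relation.Unary using (Decidable)
open import Relation.Binary.PropositionalEquality
  using (_≡_; _≢_; refl; sym; trans; cong; cong₂; subst; subst₂; module ≡-Reasoning)

module _ {a} {A : Set a} where

  ∈-─⁺ : ∀ {x y} {xs : List A} (x∈xs : x ∈ xs) → y ∈ xs → y ≢ x → y ∈ (xs ─ x∈xs)
  ∈-─⁺ (here refl) (here refl) y≢x = ⊥-elim (y≢x refl)
  ∈-─⁺ (here refl) (there y∈)  _   = y∈
  ∈-─⁺ (there x∈)  (here refl) _   = here refl
  ∈-─⁺ (there x∈)  (there y∈)  y≢x = there (∈-─⁺ x∈ y∈ y≢x)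

  Unique-⊆⇒length≤ : ∀ {xs ys : List A} → Unique xs → xs ⊆ ys → length xs ≤ length ys
  Unique-⊆⇒length≤ {[]}     _              _     = z≤n
  Unique-⊆⇒length≤ {x ∷ xs} {ys} u@(_ ∷ u′) xs⊆ys = ≤-trans
    (s≤s (Unique-⊆⇒length≤ u′ λ y∈xs →
      ∈-─⁺ x∈ys (xs⊆ys (there y∈xs)) λ { refl → Uniqueₚ.Unique[x∷xs]⇒x∉xs u y∈xs }))
    (≤-reflexive (sym (length-removeAt′ ys (Any.index x∈ys))))
    where
    x∈ys : x ∈ ys
    x∈ys = xs⊆ys (here refl)

  _‼_ : List A → ℕ → Maybe A
  []       ‼ _     = nothing
  (x ∷ xs) ‼ zero  = just x
  (x ∷ xs) ‼ suc k = xs ‼ k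

  ‼-index : ∀ {x xs} (x∈xs : x ∈ xs) → xs ‼ toℕ (Any.index x∈xs) ≡ just x
  ‼-index (here refl) = refl
  ‼-index (there x∈)  = ‼-index x∈

module _ {a b c} {A : Set a} {B : Set b} {C : Set c} (f : A → B → C) where

  length-cartesianProductWith : ∀ xs ys →
    length (cartesianProductWith f xs ys) ≡ length xs * length ys
  length-cartesianProductWith []       ys = refl
  length-cartesianProductWith (x ∷ xs) ys = trans (length-++ (map (f x) ys))
    (cong₂ _+_ (length-map (f x) ys) (length-cartesianProductWith xs ys))

  concatMap-map≡cartesianProductWith : ∀ xs ys →
    concatMap (λ x → map (f x) ys) xs ≡ cartesianProductWith f xs ys
  concatMap-map≡cartesianProductWith []       ys = refl
  concatMap-map≡cartesianProductWith (x ∷ xs) ys =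
    cong (map (f x) ys ++_) (concatMap-map≡cartesianProductWith xs ys)

module _ {a} {A : Set a} where

  vecs : List A → (k : ℕ) → List (Vec A k)
  vecs xs zero    = [] ∷ []
  vecs xs (suc k) = cartesianProductWith _∷_ xs (vecs xs k)

  length-vecs : ∀ xs k → length (vecs xs k) ≡ length xs ^ k
  length-vecs xs zero    = refl
  length-vecs xs (suc k) = trans (length-cartesianProductWith _∷_ xs (vecs xs k))
    (cong (length xs *_) (length-vecs xs k))

  ∈-vecs : ∀ {xs k} {v : Vec A k} → VecAll.All (_∈ xs) v → v ∈ vecs xs k
  ∈-vecs VecAll.[]         = here refl
  ∈-vecs (x∈xs VecAll.∷ p) = ∈-cartesianProductWith⁺ _∷_ x∈xs (∈-vecs p)

  vecs-unique : ∀ {xs} k → Unique xs → Unique (vecs xs k)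
  vecs-unique zero    _ = [] ∷ []
  vecs-unique (suc k) u = Uniqueₚ.cartesianProductWith⁺ _∷_ ∷-injective u (vecs-unique k u)

allVecs≡vecs : ∀ n k → allVecs n k ≡ vecs (List.allFin n) k
allVecs≡vecs n zero    = refl
allVecs≡vecs n (suc k) = trans
  (concatMap-map≡cartesianProductWith _∷_ (List.allFin n) (allVecs n k))
  (cong (cartesianProductWith _∷_ (List.allFin n)) (allVecs≡vecs n k))

∈-allVecs : ∀ {n k} (σ : Vec (Fin n) k) → σ ∈ allVecs n k
∈-allVecs {n} {k} σ = subst (σ ∈_) (sym (allVecs≡vecs n k)) (∈-vecs (VecAll.universal ∈-allFin σ))

module _ {a} {A : Set a} where

  ⌊⌋-true⁻ : (a? : Dec A) → ⌊ a? ⌋ ≡ true → A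
  ⌊⌋-true⁻ (yes a) _ = a

  ⌊⌋-true⁺ : (a? : Dec A) → A → ⌊ a? ⌋ ≡ true
  ⌊⌋-true⁺ (yes _) _ = refl
  ⌊⌋-true⁺ (no ¬a) a = contradiction a ¬a

  ⌊⌋-false⁺ : (a? : Dec A) → ¬ A → ⌊ a? ⌋ ≡ false
  ⌊⌋-false⁺ (yes a) ¬a = contradiction a ¬a
  ⌊⌋-false⁺ (no _)  _  = refl

∧-true⁻ : ∀ {a b} → a ∧ b ≡ true → a ≡ true × b ≡ true
∧-true⁻ {true} {true} _ = refl , refl

∧-true⁺ : ∀ {a b} → a ≡ true → b ≡ true → a ∧ b ≡ true
∧-true⁺ refl refl = refl

anyFin⁺ : ∀ {n} (p : Fin n → Bool) (x : Fin n) → p x ≡ true → anyFin p ≡ true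
anyFin⁺ p zero    px rewrite px = refl
anyFin⁺ p (suc x) px with p zero
... | true  = refl
... | false = anyFin⁺ (p ∘ suc) x px

anyFin⁻ : ∀ {n} (p : Fin n → Bool) → anyFin p ≡ true → ∃ λ x → p x ≡ true
anyFin⁻ {suc n} p h with p zero in p0
... | true  = zero , p0
... | false = let x , px = anyFin⁻ (p ∘ suc) h in suc x , px

allFin?⁺ : ∀ {n} (p : Fin n → Bool) → (∀ x → p x ≡ true) → allFin? p ≡ true
allFin?⁺ {zero}  _ _ = refl
allFin?⁺ {suc n} p h rewrite h zero = allFin?⁺ (p ∘ suc) (h ∘ suc)

allFin?⁻ : ∀ {n} (p : Fin n → Bool) → allFin? p ≡ true → ∀ x → p x ≡ true
allFin?⁻ {suc n} p h x with p zero in p0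
allFin?⁻ {suc n} p h zero    | true = p0
allFin?⁻ {suc n} p h (suc x) | true = allFin?⁻ (p ∘ suc) h x

anyFin-cong : ∀ {n} {p q : Fin n → Bool} → (∀ x → p x ≡ q x) → anyFin p ≡ anyFin q
anyFin-cong p≗q = cong (Vec.foldr _ _∨_ false) (tabulate-cong p≗q)

elements : ∀ {n} → (Fin n → Bool) → List (Fin n)
elements p = filterᵇ p (List.allFin _)

module _ {n : ℕ} (p : Fin n → Bool) where

  ∈-elements⁺ : ∀ {x} → p x ≡ true → x ∈ elements p
  ∈-elements⁺ {x} px = ∈-filter⁺ (T? ∘ p) (∈-allFin x) (Equivalence.from T-≡ px)

  ∈-elements⁻ : ∀ {x} → x ∈ elements p → p x ≡ true
  ∈-elements⁻ x∈ = Equivalence.to T-≡ (proj₂ (∈-filter⁻ (T? ∘ p) {xs = List.allFin n} x∈))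

  elements-unique : Unique (elements p)
  elements-unique = Uniqueₚ.filter⁺ (T? ∘ p) (Uniqueₚ.allFin⁺ n)

length-filterᵇ-tabulate : ∀ {a} {A : Set a} {n} (p : A → Bool) (f : Fin n → A) →
  length (filterᵇ p (List.tabulate f)) ≡ countFin (p ∘ f)
length-filterᵇ-tabulate {n = zero}  p f = refl
length-filterᵇ-tabulate {n = suc n} p f with p (f zero)
... | true  = cong suc (length-filterᵇ-tabulate p (f ∘ suc))
... | false = length-filterᵇ-tabulate p (f ∘ suc)

length-elements : ∀ {n} (p : Fin n → Bool) → length (elements p) ≡ countFin p
length-elements p = length-filterᵇ-tabulate p id

countFin-mono : ∀ {m n} {p : Fin m → Bool} {q : Fin n → Bool} (f : Fin m → Fin n) →
                Injective _≡_ _≡_ f → (∀ {x} → p x ≡ true → q (f x) ≡ true) →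
                countFin p ≤ countFin q
countFin-mono {p = p} {q} f f-inj p⇒q = begin
  countFin p                  ≡⟨ sym (length-elements p) ⟩
  length (elements p)         ≡⟨ sym (length-map f (elements p)) ⟩
  length (map f (elements p)) ≤⟨ Unique-⊆⇒length≤ (Uniqueₚ.map⁺ f-inj (elements-unique p)) f[p]⊆q ⟩
  length (elements q)         ≡⟨ length-elements q ⟩
  countFin q                  ∎
  where
  open ≤-Reasoning
  f[p]⊆q : map f (elements p) ⊆ elements q
  f[p]⊆q y∈ with x , x∈ , refl ← ∈-map⁻ f y∈ = ∈-elements⁺ q (p⇒q (∈-elements⁻ p x∈))

countFin-cong : ∀ {n} {p q : Fin n → Bool} → (∀ x → p x ≡ q x) → countFin p ≡ countFin q
countFin-cong p≗q = ≤-antisym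
  (countFin-mono id id λ {x} px → trans (sym (p≗q x)) px)
  (countFin-mono id id λ {x} qx → trans (p≗q x) qx)

∣tabulate∣≡countFin : ∀ {n} (p : Fin n → Bool) → ∣ tabulate p ∣ ≡ countFin p
∣tabulate∣≡countFin {zero}  p = refl
∣tabulate∣≡countFin {suc n} p with p zero
... | true  = cong suc (∣tabulate∣≡countFin (p ∘ suc))
... | false = ∣tabulate∣≡countFin (p ∘ suc)

module _ {n : ℕ} where

  Unique⇒length≤ : {xs : List (Fin n)} → Unique xs → length xs ≤ n
  Unique⇒length≤ u = ≤-trans (Unique-⊆⇒length≤ u λ {x} _ → ∈-allFin x) (≤-reflexive (length-tabulate id))

  countFin≤n : (p : Fin n → Bool) → countFin p ≤ n
  countFin≤n p = subst (_≤ n) (length-elements p) (Unique⇒length≤ (elements-unique p))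

  countFin-pos : (p : Fin n → Bool) {x : Fin n} → p x ≡ true → 1 ≤ countFin p
  countFin-pos p px = subst (1 ≤_) (length-elements p)
    (Unique-⊆⇒length≤ ([] ∷ []) λ { (here refl) → ∈-elements⁺ p px })

  countFin-inter : (p q : Fin n → Bool) → n < countFin p + countFin q →
                   ∃ λ x → p x ≡ true × q x ≡ true
  countFin-inter p q n< with any? (λ x → p x ∧ q x Bool.≟ true)
  ... | yes (x , pqx) = x , ∧-true⁻ pqx
  ... | no ¬pq = contradiction n< (≤⇒≯ (begin
    countFin p + countFin q                   ≡⟨ sym (cong₂ _+_ (length-elements p) (length-elements q)) ⟩
    length (elements p) + length (elements q) ≡⟨ sym (length-++ (elements p)) ⟩
    length (elements p ++ elements q)         ≤⟨ Unique⇒length≤ (Uniqueₚ.++⁺ (elements-unique p) (elements-unique q) disjoint) ⟩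
    n                                         ∎))
    where
    open ≤-Reasoning
    disjoint : Disjoint (elements p) (elements q)
    disjoint (x∈p , x∈q) = ¬pq (_ , ∧-true⁺ (∈-elements⁻ p x∈p) (∈-elements⁻ q x∈q))

  countFin-remove : (p : Fin n → Bool) {x : Fin n} → p x ≡ true →
                    suc (countFin (λ y → p y ∧ not ⌊ y ≟ x ⌋)) ≤ countFin p
  countFin-remove p {x} px = subst₂ (λ a b → suc a ≤ b) (length-elements p-x) (length-elements p)
    (Unique-⊆⇒length≤ (All.tabulate x≢ ∷ elements-unique p-x) x∷p-x⊆p)
    where
    p-x : Fin n → Bool
    p-x y = p y ∧ not ⌊ y ≟ x ⌋
    x≢ : ∀ {y} → y ∈ elements p-x → x ≢ y
    x≢ y∈ refl with () ← trans (sym (proj₂ (∧-true⁻ {p x} (∈-elements⁻ p-x y∈))))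
                                (cong not (⌊⌋-true⁺ (x ≟ x) refl))
    x∷p-x⊆p : x ∷ elements p-x ⊆ elements p
    x∷p-x⊆p (here refl) = ∈-elements⁺ p px
    x∷p-x⊆p (there y∈)  = ∈-elements⁺ p (proj₁ (∧-true⁻ (∈-elements⁻ p-x y∈)))

injective⇒surjective : ∀ {n} {f : Fin n → Fin n} → Injective _≡_ _≡_ f →
                       ∀ y → ∃ λ x → f x ≡ y
injective⇒surjective {suc n} {f} f-inj y with any? (λ x → f x ≟ y)
... | yes hit  = hit
... | no  miss = contradiction (injective⇒≤ punchOut-inj) (n≮n n)
  where
  y≢f : ∀ x → y ≢ f x
  y≢f x y≡fx = miss (x , sym y≡fx)
  punchOut-inj : Injective _≡_ _≡_ (λ x → punchOut (y≢f x))
  punchOut-inj e = f-inj (punchOut-injective (y≢f _) (y≢f _) e)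

injective⇒permutation : ∀ {n} {f : Fin n → Fin n} → Injective _≡_ _≡_ f → Permutation′ n
injective⇒permutation {f = f} f-inj =
  permutation f (proj₁ ∘ surj) (proj₂ ∘ surj) (λ x → f-inj (proj₂ (surj (f x))))
  where
  surj : ∀ y → ∃ λ x → f x ≡ y
  surj = injective⇒surjective f-inj

module _ {n : ℕ} (π : Permutation′ n) where

  ⟨$⟩ʳ-injective : Injective _≡_ _≡_ (π ⟨$⟩ʳ_)
  ⟨$⟩ʳ-injective e = trans (sym (inverseˡ π)) (trans (cong (π ⟨$⟩ˡ_) e) (inverseˡ π))

  ⟨$⟩ˡ-injective : Injective _≡_ _≡_ (π ⟨$⟩ˡ_)
  ⟨$⟩ˡ-injective e = trans (sym (inverseʳ π)) (trans (cong (π ⟨$⟩ʳ_) e) (inverseʳ π))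

  countFin-∘-permutation : (p : Fin n → Bool) → countFin (p ∘ (π ⟨$⟩ʳ_)) ≡ countFin p
  countFin-∘-permutation p = ≤-antisym
    (countFin-mono (π ⟨$⟩ʳ_) ⟨$⟩ʳ-injective id)
    (countFin-mono (π ⟨$⟩ˡ_) ⟨$⟩ˡ-injective (subst (λ y → p y ≡ true) (sym (inverseʳ π))))

module _ {n : ℕ} (a b : Fin n) where

  transpose-matchˡ : transpose a b ⟨$⟩ʳ a ≡ b
  transpose-matchˡ rewrite dec-true (a ≟ a) refl = refl

  transpose-matchʳ : transpose a b ⟨$⟩ʳ b ≡ a
  transpose-matchʳ with b ≟ a
  ... | yes b≡a = b≡a
  ... | no  _   rewrite dec-true (b ≟ b) refl = refl

  transpose-fix : ∀ {x} → x ≢ a → x ≢ b → transpose a b ⟨$⟩ʳ x ≡ x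
  transpose-fix {x} x≢a x≢b with x ≟ a
  ... | yes x≡a = contradiction x≡a x≢a
  ... | no  _ with x ≟ b
  ...   | yes x≡b = contradiction x≡b x≢b
  ...   | no  _   = refl

data Walk {A : Set} (R : A → A → Set) : A → List A → A → Set where
  [_] : ∀ {x y} → R x y → Walk R x [] y
  _∷_ : ∀ {x y ys z} → R x y → Walk R y ys z → Walk R x (y ∷ ys) z

module _ {A : Set} {R S : A → A → Set} where

  Walk-map : (∀ {x y} → R x y → S x y) → ∀ {s ys e} → Walk R s ys e → Walk S s ys e
  Walk-map f [ r ]   = [ f r ]
  Walk-map f (r ∷ w) = f r ∷ Walk-map f w

  Walk-zip : ∀ {s ys e} → Walk R s ys e → Walk S s ys e → Walk (λ x y → R x y × S x y) s ys e
  Walk-zip [ r ]   [ q ]   = [ r , q ]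
  Walk-zip (r ∷ w) (q ∷ v) = (r , q) ∷ Walk-zip w v

module _ {A : Set} {R : A → A → Set} where

  Walk-head : ∀ {s x xs e} → Walk R s (x ∷ xs) e → R s x
  Walk-head (r ∷ _) = r

  Walk-successor : ∀ {s ys e x} → Walk R s ys e → x ∈ s ∷ ys → ∃ (R x)
  Walk-successor [ r ]   (here refl) = _ , r
  Walk-successor (r ∷ _) (here refl) = _ , r
  Walk-successor (_ ∷ w) (there x∈)  = Walk-successor w x∈

Unique⇒Walk≢ : ∀ {A : Set} {s x : A} {xs} → Unique (s ∷ x ∷ xs) → Walk _≢_ s (x ∷ xs) s
Unique⇒Walk≢ {s = s} (s∉@(s≢x ∷ _) ∷ u) = s≢x ∷ go u s∉
  where
  go : ∀ {y ys} → Unique (y ∷ ys) → All (s ≢_) (y ∷ ys) → Walk _≢_ y ys s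
  go {ys = []}     _               (s≢y ∷ []) = [ s≢y ∘ sym ]
  go {ys = z ∷ zs} ((y≢z ∷ _) ∷ u) (_ ∷ s∉)   = y≢z ∷ go u s∉

module _ {n : ℕ} where

  rotation : List (Fin n) → Permutation′ n
  rotation (a ∷ b ∷ r) = rotation (b ∷ r) ∘ₚ transpose a b
  rotation _           = Perm.id

  rotation-fix : ∀ xs {x} → x ∉ xs → rotation xs ⟨$⟩ʳ x ≡ x
  rotation-fix []          _  = refl
  rotation-fix (a ∷ [])    _  = refl
  rotation-fix (a ∷ b ∷ r) x∉ = trans (cong (transpose a b ⟨$⟩ʳ_) (rotation-fix (b ∷ r) (x∉ ∘ there)))
                                     (transpose-fix a b (x∉ ∘ here) (x∉ ∘ there ∘ here))

  rotation-walk : ∀ {a} xs → Unique (a ∷ xs) → Walk (λ y z → rotation (a ∷ xs) ⟨$⟩ʳ y ≡ z) a xs a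
  rotation-walk []      _                                 = [ refl ]
  rotation-walk {a} (b ∷ r) uab@((_ ∷ a∉r) ∷ u@(b∉r ∷ _)) =
    trans (cong (transpose a b ⟨$⟩ʳ_) (rotation-fix (b ∷ r) (Uniqueₚ.Unique[x∷xs]⇒x∉xs uab)))
          (transpose-matchˡ a b)
    ∷ retarget (rotation-walk r u) a∉r b∉r
    where
    retarget : ∀ {y zs} → Walk (λ y z → rotation (b ∷ r) ⟨$⟩ʳ y ≡ z) y zs b →
               All (a ≢_) zs → All (b ≢_) zs →
               Walk (λ y z → rotation (a ∷ b ∷ r) ⟨$⟩ʳ y ≡ z) y zs a
    retarget [ e ]   []         []         = [ trans (cong (transpose a b ⟨$⟩ʳ_) e) (transpose-matchʳ a b) ]
    retarget (e ∷ w) (a≢z ∷ a∉) (b≢z ∷ b∉) =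
      trans (cong (transpose a b ⟨$⟩ʳ_) e) (transpose-fix a b (a≢z ∘ sym) (b≢z ∘ sym)) ∷ retarget w a∉ b∉

x*[y*z]≡y*[x*z] : ∀ x y z → x * (y * z) ≡ y * (x * z)
x*[y*z]≡y*[x*z] x y z = trans (sym (*-assoc x y z)) (trans (cong (_* z) (*-comm x y)) (*-assoc y x z))

^-distribʳ-* : ∀ m n o → (m * n) ^ o ≡ m ^ o * n ^ o
^-distribʳ-* m n zero    = refl
^-distribʳ-* m n (suc o) = trans (cong (m * n *_) (^-distribʳ-* m n o))
                                 ([m*n]*[o*p]≡[m*o]*[n*p] m n (m ^ o) (n ^ o))

^-comm-exponents : ∀ m n o → (m ^ n) ^ o ≡ (m ^ o) ^ n
^-comm-exponents m n o = trans (^-*-assoc m n o) (trans (cong (m ^_) (*-comm n o)) (sym (^-*-assoc m o n)))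

greatest≤ : ∀ {p} {P : ℕ → Set p} → Decidable P → P 0 → ∀ N →
            ∃ λ J → P J × (∀ {m} → m ≤ N → P m → m ≤ J)
greatest≤ P? P0 zero = 0 , P0 , λ { z≤n _ → z≤n }
greatest≤ {P = P} P? P0 (suc N) with P? (suc N)
... | yes PN = suc N , PN , λ m≤ _ → m≤
... | no ¬PN with J , PJ , max ← greatest≤ P? P0 N = J , PJ , below
  where
  below : ∀ {m} → m ≤ suc N → P m → m ≤ J
  below m≤ Pm with m≤n⇒m<n∨m≡n m≤
  ... | inj₁ m<1+N = max (≤-pred m<1+N) Pm
  ... | inj₂ refl  = contradiction Pm ¬PN

least : ∀ {p} {P : ℕ → Set p} → Decidable P → ∀ {k} → P k →
        ∃ λ m → m ≤ k × P m × (∀ {m′} → m′ < m → ¬ P m′)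
least P? {zero}  P0 = 0 , z≤n , P0 , λ ()
least P? {suc k} Pk with P? 0
... | yes P0  = 0 , z≤n , P0 , λ ()
... | no  ¬P0 with m , m≤k , Pm , min ← least (P? ∘ suc) Pk =
  suc m , s≤s m≤k , Pm , λ { {zero} _ → ¬P0 ; {suc m′} m′<m → min (≤-pred m′<m) }

half-sum : ∀ {n a b} → n < 2 * a → n < 2 * b → n < a + b
half-sum {n} {a} {b} n<2a n<2b = *-cancelˡ-< 2 n (a + b) (begin-strict
  2 * n         ≡⟨ cong (n +_) (+-identityʳ n) ⟩
  n + n         <⟨ +-mono-< n<2a n<2b ⟩
  2 * a + 2 * b ≡⟨ sym (*-distribˡ-+ 2 a b) ⟩
  2 * (a + b)   ∎)
  where open ≤-Reasoning

module _ {A B : ℕ} (B<A : B < A) where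

  expansion-strict : ∀ {x y} → 0 < x → A * x ≤ B * y → x < y
  expansion-strict {x} {y} 0<x Ax≤By = *-cancelˡ-< B x y
    (<-≤-trans (*-monoˡ-< x {{>-nonZero 0<x}} B<A) Ax≤By)

  expansion-iterate : ∀ {t x y} → A ^ t ≤ B ^ t * x → A * x ≤ B * y →
                      A ^ suc t ≤ B ^ suc t * y
  expansion-iterate {t} {x} {y} Aᵗ≤ Ax≤By = begin
    A * A ^ t       ≤⟨ *-monoʳ-≤ A Aᵗ≤ ⟩
    A * (B ^ t * x) ≡⟨ x*[y*z]≡y*[x*z] A (B ^ t) x ⟩
    B ^ t * (A * x) ≤⟨ *-monoʳ-≤ (B ^ t) Ax≤By ⟩
    B ^ t * (B * y) ≡⟨ x*[y*z]≡y*[x*z] (B ^ t) B y ⟩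
    B * (B ^ t * y) ≡⟨ sym (*-assoc B (B ^ t) y) ⟩
    B * B ^ t * y   ∎
    where open ≤-Reasoning

  -- Strict growth keeps c t > t, so the sequence cannot stay at most n/2 up to t = n.
  module _ {n : ℕ} (c : ℕ → ℕ) (c≤n : ∀ t → c t ≤ n) (0<c₀ : 0 < c 0)
           (expands : ∀ t → 2 * c t ≤ n → A * c t ≤ B * c (suc t)) where

    private
      Exceeded : ℕ → Set
      Exceeded t = ∃ λ t′ → t′ ≤ t × n < 2 * c t′ × A ^ t′ ≤ B ^ t′ * c t′

      Small : ℕ → Set
      Small t = A ^ t ≤ B ^ t * c t × t < c t × 2 * c t ≤ n

      classify : ∀ t → A ^ t ≤ B ^ t * c t → t < c t → Exceeded t ⊎ Small t
      classify t bound t<c with 2 * c t ≤? n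
      ... | yes small = inj₂ (bound , t<c , small)
      ... | no  big   = inj₁ (t , ≤-refl , ≰⇒> big , bound)

      search : ∀ t → Exceeded t ⊎ Small t
      search zero = classify 0 (≤-trans 0<c₀ (≤-reflexive (sym (*-identityˡ (c 0))))) 0<c₀
      search (suc t) with search t
      ... | inj₁ (t′ , t′≤t , big , bound) = inj₁ (t′ , m≤n⇒m≤1+n t′≤t , big , bound)
      ... | inj₂ (bound , t<c , small)     = classify (suc t)
        (expansion-iterate {t} bound (expands t small))
        (≤-<-trans t<c (expansion-strict (≤-<-trans z≤n t<c) (expands t small)))

    exceeds-half : ∃ λ t → t ≤ n × n < 2 * c t × A ^ t ≤ B ^ t * c t
    exceeds-half with search n
    ... | inj₁ exceeded      = exceeded
    ... | inj₂ (_ , n<c , _) = contradiction (c≤n n) (<⇒≱ n<c)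

expansion-product : ∀ {A B x y N} s t → A ^ s ≤ B ^ s * x → A ^ t ≤ B ^ t * y → x ≤ N → y ≤ N →
                    A ^ (s + t) ≤ B ^ (s + t) * (N * N)
expansion-product {A} {B} {x} {y} {N} s t Aˢ≤ Aᵗ≤ x≤N y≤N = begin
  A ^ (s + t)               ≡⟨ ^-distribˡ-+-* A s t ⟩
  A ^ s * A ^ t             ≤⟨ *-mono-≤ Aˢ≤ Aᵗ≤ ⟩
  (B ^ s * x) * (B ^ t * y) ≤⟨ *-mono-≤ (*-monoʳ-≤ (B ^ s) x≤N) (*-monoʳ-≤ (B ^ t) y≤N) ⟩
  (B ^ s * N) * (B ^ t * N) ≡⟨ [m*n]*[o*p]≡[m*o]*[n*p] (B ^ s) N (B ^ t) N ⟩
  (B ^ s * B ^ t) * (N * N) ≡⟨ cong (_* (N * N)) (sym (^-distribˡ-+-* B s t)) ⟩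
  B ^ (s + t) * (N * N)     ∎
  where open ≤-Reasoning

exponent-transfer : ∀ {D A B N} a b J → 0 < B → D ^ b * B ^ a ≤ A ^ a → A ^ J ≤ B ^ J * N →
                    (D ^ J) ^ b ≤ N ^ a
exponent-transfer {D} {A} {B} {N} a b J 0<B Dᵇ≤ Aᴶ≤ = *-cancelʳ-≤ ((D ^ J) ^ b) (N ^ a) ((B ^ J) ^ a)
  {{>-nonZero (m^n>0 (B ^ J) {{>-nonZero (m^n>0 B {{>-nonZero 0<B}} J)}} a)}} (begin
  (D ^ J) ^ b * (B ^ J) ^ a ≡⟨ cong₂ _*_ (^-comm-exponents D J b) (^-comm-exponents B J a) ⟩
  (D ^ b) ^ J * (B ^ a) ^ J ≡⟨ sym (^-distribʳ-* (D ^ b) (B ^ a) J) ⟩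
  (D ^ b * B ^ a) ^ J       ≤⟨ ^-monoˡ-≤ J Dᵇ≤ ⟩
  (A ^ a) ^ J               ≡⟨ ^-comm-exponents A a J ⟩
  (A ^ J) ^ a               ≤⟨ ^-monoˡ-≤ a Aᴶ≤ ⟩
  (B ^ J * N) ^ a           ≡⟨ ^-distribʳ-* (B ^ J) N a ⟩
  (B ^ J) ^ a * N ^ a       ≡⟨ *-comm ((B ^ J) ^ a) (N ^ a) ⟩
  N ^ a * (B ^ J) ^ a       ∎)
  where open ≤-Reasoning

1+D*Y-bound : ∀ D Y {b C} → Y ^ b ≤ C → 1 ≤ C → (1 + D * Y) ^ b ≤ (1 + D) ^ b * C
1+D*Y-bound D zero {b} {C} _ 1≤C = begin
  (1 + D * 0) ^ b ≡⟨ cong (λ z → (1 + z) ^ b) (*-zeroʳ D) ⟩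
  1 ^ b           ≡⟨ ^-zeroˡ b ⟩
  1 * 1           ≤⟨ *-mono-≤ (m^n>0 (1 + D) b) 1≤C ⟩
  (1 + D) ^ b * C ∎
  where open ≤-Reasoning
1+D*Y-bound D Y@(suc _) {b} {C} Yᵇ≤C _ = begin
  (1 + D * Y) ^ b     ≤⟨ ^-monoˡ-≤ b (+-monoˡ-≤ (D * Y) (s≤s z≤n)) ⟩
  ((1 + D) * Y) ^ b   ≡⟨ ^-distribʳ-* (1 + D) Y b ⟩
  (1 + D) ^ b * Y ^ b ≤⟨ *-monoʳ-≤ ((1 + D) ^ b) Yᵇ≤C ⟩
  (1 + D) ^ b * C     ∎
  where open ≤-Reasoning

count-bound : ∀ {N T D Y C} b → N ≤ T * (1 + D * Y) → Y ^ b ≤ C → 1 ≤ C →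
              N ^ b ≤ (1 + D) ^ b * T ^ b * C
count-bound {N} {T} {D} {Y} {C} b N≤ Yᵇ≤C 1≤C = begin
  N ^ b                     ≤⟨ ^-monoˡ-≤ b N≤ ⟩
  (T * (1 + D * Y)) ^ b     ≡⟨ ^-distribʳ-* T (1 + D * Y) b ⟩
  T ^ b * (1 + D * Y) ^ b   ≤⟨ *-monoʳ-≤ (T ^ b) (1+D*Y-bound D Y {b} Yᵇ≤C 1≤C) ⟩
  T ^ b * ((1 + D) ^ b * C) ≡⟨ x*[y*z]≡y*[x*z] (T ^ b) ((1 + D) ^ b) C ⟩
  (1 + D) ^ b * (T ^ b * C) ≡⟨ sym (*-assoc ((1 + D) ^ b) (T ^ b) C) ⟩
  (1 + D) ^ b * T ^ b * C   ∎
  where open ≤-Reasoning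

-- Layers of a relation

module Layers {n : ℕ} (R : Fin n → Fin n → Bool) where

  Step : Fin n → Fin n → Set
  Step x y = R x y ≡ true

  forward : Fin n → ℕ → Fin n → Bool
  forward s zero    y = ⌊ y ≟ s ⌋
  forward s (suc t) y = anyFin (λ x → forward s t x ∧ R x y)

  backward : Fin n → ℕ → Fin n → Bool
  backward e zero    x = ⌊ x ≟ e ⌋
  backward e (suc k) x = anyFin (λ y → backward e k y ∧ R x y)

  backward-step : ∀ {e k x y} → Step x y → backward e k y ≡ true → backward e (suc k) x ≡ true
  backward-step {e} {k} {x} {y} xRy y∈ = anyFin⁺ (λ y → backward e k y ∧ R x y) y (∧-true⁺ y∈ xRy)

  backward-suc⁻ : ∀ {e k x} → backward e (suc k) x ≡ true → ∃ λ y → backward e k y ≡ true × Step x y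
  backward-suc⁻ {e} {k} {x} x∈ with y , y∈ ← anyFin⁻ (λ y → backward e k y ∧ R x y) x∈ = y , ∧-true⁻ y∈

  forward-suc⁻ : ∀ {s t y} → forward s (suc t) y ≡ true → ∃ λ x → forward s t x ≡ true × Step x y
  forward-suc⁻ {s} {t} {y} y∈ with x , x∈ ← anyFin⁻ (λ x → forward s t x ∧ R x y) y∈ = x , ∧-true⁻ x∈

  backward-join : ∀ {s e} t {k y} → forward s t y ≡ true → backward e k y ≡ true →
                  backward e (k + t) s ≡ true
  backward-join {s} zero {k} y∈ y∈′ rewrite ⌊⌋-true⁻ (_ ≟ s) y∈ | +-identityʳ k = y∈′
  backward-join {s} {e} (suc t) {k} y∈ y∈′ with _ , x∈ , xRy ← forward-suc⁻ {s} {t} y∈ rewrite +-suc k t =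
    backward-join t {suc k} x∈ (backward-step {e} {k} xRy y∈′)

  module _ (e : Fin n) where

    private
      Minimal : ℕ → Fin n → Set
      Minimal k x = ∀ {k′} → k′ < k → ¬ (backward e k′ x ≡ true)

      Near : ℕ → Fin n → Set
      Near k z = ∃ λ j → j ≤ k × backward e j z ≡ true

      e≢ : ∀ {k x} → Minimal (suc k) x → e ≢ x
      e≢ {x = x} min refl = min (s≤s z≤n) (⌊⌋-true⁺ (x ≟ x) refl)

      -- A vertex on the walk equal to x would reach e in fewer than suc k steps.
      walk : ∀ k {x} → backward e (suc k) x ≡ true → Minimal (suc k) x →
             ∃ λ xs → Walk Step x xs e × length xs ≡ k × Unique (e ∷ x ∷ xs) × All (Near (suc k)) (x ∷ xs)
      walk zero x∈ min with y , y∈ , xRy ← backward-suc⁻ {e} {0} x∈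
                           with refl ← ⌊⌋-true⁻ (y ≟ e) y∈ =
        [] , [ xRy ] , refl , (e≢ min ∷ []) ∷ [] ∷ [] , (1 , ≤-refl , x∈) ∷ []
      walk (suc k) {x} x∈ min
        with y , y∈ , xRy ← backward-suc⁻ {e} {suc k} x∈
        with ys , w , len , e∉ ∷ u , near ←
               walk k y∈ (λ {k′} k′< y∈′ → min (s≤s k′<) (backward-step {e} {k′} xRy y∈′)) =
        y ∷ ys , xRy ∷ w , cong suc len , (e≢ min ∷ e∉) ∷ All.map x≢ near ∷ u ,
        (suc (suc k) , ≤-refl , x∈) ∷ All.map (λ (j , j≤ , z∈) → j , m≤n⇒m≤1+n j≤ , z∈) near
        where
        x≢ : ∀ {z} → Near (suc k) z → x ≢ z
        x≢ (j , j≤ , z∈) refl = min (s≤s j≤) z∈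

    shortest-walk : ∀ {k s} → backward e k s ≡ true → s ≢ e →
                    ∃ λ xs → Walk Step s xs e × length (s ∷ xs) ≤ k × Unique (e ∷ s ∷ xs)
    shortest-walk {k} {s} s∈ s≢e with least (λ k → backward e k s Bool.≟ true) s∈
    ... | zero  , _     , s∈₀ , _   = contradiction (⌊⌋-true⁻ (s ≟ e) s∈₀) s≢e
    ... | suc m , 1+m≤k , s∈ₘ , min with xs , w , refl , u , _ ← walk m s∈ₘ min = xs , w , 1+m≤k , u

-- Perfect matchings, expansion and alternating cycles

module _ {n : ℕ} (G : BipGraph n) where

  Follows : (Fin n → Fin n) → Set
  Follows f = ∀ x → Adj G x (f x) ≡ true

  isPerfectMatching⁻ : ∀ {σ} → IsPerfectMatching G σ ≡ true →
                       Follows (lookup σ) × Injective _≡_ _≡_ (lookup σ)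
  isPerfectMatching⁻ {σ} pm with follows , distinct ← ∧-true⁻ pm = allFin?⁻ _ follows , injective
    where
    injective : Injective _≡_ _≡_ (lookup σ)
    injective {x} {y} σx≡σy = ⌊⌋-true⁻ (x ≟ y) (trans (sym (∨-identityʳ _)) (subst
      (λ b → (⌊ x ≟ y ⌋ ∨ not b) ≡ true) (⌊⌋-true⁺ (lookup σ x ≟ lookup σ y) σx≡σy)
      (allFin?⁻ _ (allFin?⁻ _ distinct x) y)))

  isPerfectMatching⁺ : ∀ {f} → Follows f → Injective _≡_ _≡_ f → IsPerfectMatching G (tabulate f) ≡ true
  isPerfectMatching⁺ {f} follows injective = ∧-true⁺
    (allFin?⁺ _ λ x → subst (λ w → Adj G x w ≡ true) (sym (lookup∘tabulate f x)) (follows x))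
    (allFin?⁺ _ λ x → allFin?⁺ _ λ y → distinct x y)
    where
    distinct : ∀ x y → (⌊ x ≟ y ⌋ ∨ not ⌊ lookup (tabulate f) x ≟ lookup (tabulate f) y ⌋) ≡ true
    distinct x y with x ≟ y
    ... | yes _ = refl
    ... | no x≢y rewrite lookup∘tabulate f x | lookup∘tabulate f y
                       | ⌊⌋-false⁺ (f x ≟ f y) (x≢y ∘ injective) = refl

  ∈-perfectMatchings⁺ : ∀ {σ} → IsPerfectMatching G σ ≡ true → σ ∈ perfectMatchings G
  ∈-perfectMatchings⁺ {σ} pm =
    ∈-filter⁺ (λ σ → T? (IsPerfectMatching G σ)) (∈-allVecs σ) (Equivalence.from T-≡ pm)

  ∈-perfectMatchings⁻ : ∀ {σ} → σ ∈ perfectMatchings G → IsPerfectMatching G σ ≡ true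
  ∈-perfectMatchings⁻ σ∈ = Equivalence.to T-≡
    (proj₂ (∈-filter⁻ (λ σ → T? (IsPerfectMatching G σ)) {xs = allVecs n n} σ∈))

  perfectMatchings-unique : Unique (perfectMatchings G)
  perfectMatchings-unique = Uniqueₚ.filter⁺ (λ σ → T? (IsPerfectMatching G σ))
    (subst Unique (sym (allVecs≡vecs n n)) (vecs-unique n (Uniqueₚ.allFin⁺ n)))

  asPermutation : ∀ {σ} → IsPerfectMatching G σ ≡ true → Permutation′ n
  asPermutation {σ} pm = injective⇒permutation {f = lookup σ} (proj₂ (isPerfectMatching⁻ {σ} pm))

  Nᵁ : (Fin n → Bool) → Fin n → Bool
  Nᵁ p w = anyFin (λ x → p x ∧ Adj G x w)

  Nⱽ : (Fin n → Bool) → Fin n → Bool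
  Nⱽ q x = anyFin (λ w → q w ∧ Adj G x w)

  module _ {u v} (expander : IsExpander G u v) where

    expandsᵁ : ∀ p → 2 * countFin p ≤ n → (v + u) * countFin p ≤ v * countFin (Nᵁ p)
    expandsᵁ p small = subst₂ (λ a b → (v + u) * a ≤ v * b) (∣tabulate∣≡countFin p)
      (trans (∣tabulate∣≡countFin (Nᵁ (lookup (tabulate p))))
             (countFin-cong λ w → anyFin-cong λ x → cong (_∧ Adj G x w) (lookup∘tabulate p x)))
      (proj₁ expander (tabulate p) (subst (λ a → 2 * a ≤ n) (sym (∣tabulate∣≡countFin p)) small))

    expandsⱽ : ∀ q → 2 * countFin q ≤ n → (v + u) * countFin q ≤ v * countFin (Nⱽ q)
    expandsⱽ q small = subst₂ (λ a b → (v + u) * a ≤ v * b) (∣tabulate∣≡countFin q)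
      (trans (∣tabulate∣≡countFin (Nⱽ (lookup (tabulate q))))
             (countFin-cong λ x → anyFin-cong λ w → cong (_∧ Adj G x w) (lookup∘tabulate q w)))
      (proj₂ expander (tabulate q) (subst (λ a → 2 * a ≤ n) (sym (∣tabulate∣≡countFin q)) small))

-- A step x ⟶ y means that x is adjacent to the partner σ y of y, so x, σ y, y is an alternating
-- path.  Each forward layer is σ⁻¹ (Nᵁ X) and each backward layer is Nⱽ (σ Y) for the previous one.
module Alternating {n : ℕ} (G : BipGraph n) (σ : Permutation′ n) where

  open Layers (λ x y → Adj G x (σ ⟨$⟩ʳ y))
    using (Step; forward; backward; backward-step; backward-join; shortest-walk)

  module _ {u v} (0<u : 0 < u) (expander : IsExpander G u v) where

    forward-expands : ∀ s t → 2 * countFin (forward s t) ≤ n →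
                      (v + u) * countFin (forward s t) ≤ v * countFin (forward s (suc t))
    forward-expands s t small = subst (λ c → (v + u) * countFin (forward s t) ≤ v * c)
      (sym (countFin-∘-permutation σ (Nᵁ G (forward s t)))) (expandsᵁ G {u} {v} expander (forward s t) small)

    backward-expands : ∀ e k → 2 * countFin (backward e k) ≤ n →
                       (v + u) * countFin (backward e k) ≤ v * countFin (backward e (suc k))
    backward-expands e k small = begin
      (v + u) * countFin (backward e k) ≡⟨ cong ((v + u) *_) (sym σ[layer]) ⟩
      (v + u) * countFin q              ≤⟨ expandsⱽ G {u} {v} expander q (subst (λ c → 2 * c ≤ n) (sym σ[layer]) small) ⟩
      v * countFin (Nⱽ G q)             ≤⟨ *-monoʳ-≤ v (countFin-mono {p = Nⱽ G q} {backward e (suc k)} id id Nⱽq⇒backward) ⟩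
      v * countFin (backward e (suc k)) ∎
      where
      open ≤-Reasoning
      q : Fin n → Bool
      q = backward e k ∘ (σ ⟨$⟩ˡ_)
      σ[layer] : countFin q ≡ countFin (backward e k)
      σ[layer] = countFin-∘-permutation (Perm.flip σ) (backward e k)
      Nⱽq⇒backward : ∀ {x} → Nⱽ G q x ≡ true → backward e (suc k) x ≡ true
      Nⱽq⇒backward {x} x∈ with w , qw∧xw ← anyFin⁻ (λ w → q w ∧ Adj G x w) x∈
                          with qw , xw ← ∧-true⁻ qw∧xw =
        backward-step {e} {k} (subst (λ w → Adj G x w ≡ true) (sym (inverseʳ σ)) xw) qw

    private
      v<v+u : v < v + u
      v<v+u = m<m+n v 0<u

    module _ {i j} (ij : Adj G i j ≡ true) (σi≢j : σ ⟨$⟩ʳ i ≢ j) where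

      private
        i′ : Fin n
        i′ = σ ⟨$⟩ˡ j

        X Y : ℕ → Fin n → Bool
        X = forward i′
        Y = backward i

        i′≢i : i′ ≢ i
        i′≢i i′≡i = σi≢j (trans (cong (σ ⟨$⟩ʳ_) (sym i′≡i)) (inverseʳ σ))

        i⟶i′ : Step i i′
        i⟶i′ = subst (λ w → Adj G i w ≡ true) (sym (inverseʳ σ)) ij

      alternating-cycle :
        ∃ λ rest → Unique (i ∷ i′ ∷ rest) × Walk Step i (i′ ∷ rest) i ×
                   ∃ λ m → length (i′ ∷ rest) ≤ m × m ≤ n + n × (v + u) ^ m ≤ v ^ m * (n * n)
      alternating-cycle
        with t , t≤n , bigᵗ , boundᵗ ← exceeds-half v<v+u (countFin ∘ X) (countFin≤n ∘ X)
                                          (countFin-pos (X 0) (⌊⌋-true⁺ (i′ ≟ i′) refl)) (forward-expands i′)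
        with s , s≤n , bigˢ , boundˢ ← exceeds-half v<v+u (countFin ∘ Y) (countFin≤n ∘ Y)
                                          (countFin-pos (Y 0) (⌊⌋-true⁺ (i ≟ i) refl)) (backward-expands i)
        with x , x∈Xₜ , x∈Yₛ ← countFin-inter (X t) (Y s) (half-sum {n} {countFin (X t)} bigᵗ bigˢ)
        with rest , w , len≤ , uniq ← shortest-walk i (backward-join {i′} {i} t {s} x∈Xₜ x∈Yₛ) i′≢i =
        rest , uniq , i⟶i′ ∷ w , s + t , len≤ , +-mono-≤ s≤n t≤n ,
        expansion-product s t boundˢ boundᵗ (countFin≤n (Y s)) (countFin≤n (X t))

-- Each step y ⟶ z of the cycle is recorded by the position of z among the other U-neighbours of
-- the new partner of y; codes are padded with 0, and decoding stops on returning to i.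
module Coding {n : ℕ} (G : BipGraph n) (i : Fin n) where

  others : Fin n → Fin n → List (Fin n)
  others w y = elements (λ z → Adj G z w ∧ not ⌊ z ≟ y ⌋)

  Successor : (Fin n → Fin n) → Fin n → Fin n → Set
  Successor f y z = z ∈ others (f y) y

  decode : (Fin n → Fin n) → Fin n → ∀ {k} → Vec ℕ k → List (Fin n)
  decode f y []       = []
  decode f y (c ∷ cs) with others (f y) y ‼ c
  ... | nothing = []
  ... | just z with z ≟ i
  ...   | yes _ = []
  ...   | no  _ = z ∷ decode f z cs

  encode : ∀ {f y xs} → Walk (Successor f) y xs i → (k : ℕ) → Vec ℕ k
  encode _        zero    = []
  encode [ z∈ ]   (suc k) = toℕ (Any.index z∈) ∷ Vec.replicate k 0
  encode (z∈ ∷ w) (suc k) = toℕ (Any.index z∈) ∷ encode w k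

  decode-encode : ∀ {f y xs} (w : Walk (Successor f) y xs i) {k} → length xs < k → All (_≢ i) xs →
                  decode f y (encode w k) ≡ xs
  decode-encode [ i∈ ] {suc k} _ [] rewrite ‼-index i∈ with i ≟ i
  ... | yes _   = refl
  ... | no  i≢i = contradiction refl i≢i
  decode-encode {xs = z ∷ _} (z∈ ∷ w) {suc k} (s≤s len<k) (z≢i ∷ ≢i) rewrite ‼-index z∈ with z ≟ i
  ... | yes z≡i = contradiction z≡i z≢i
  ... | no  _   = cong (z ∷_) (decode-encode w len<k ≢i)

  encode-< : ∀ {D f} → (∀ y → length (others (f y) y) ≤ D) →
             ∀ {y xs} (w : Walk (Successor f) y xs i) k → VecAll.All (_< D) (encode w k)
  encode-< bound w        zero    = VecAll.[]
  encode-< bound (z∈ ∷ w) (suc k) = <-≤-trans (toℕ<n (Any.index z∈)) (bound _) VecAll.∷ encode-< bound w k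
  encode-< {D} bound [ z∈ ] (suc k) = c<D VecAll.∷ padding k
    where
    c<D : toℕ (Any.index z∈) < D
    c<D = <-≤-trans (toℕ<n (Any.index z∈)) (bound _)
    padding : ∀ k → VecAll.All (_< D) (Vec.replicate k 0)
    padding zero    = VecAll.[]
    padding (suc k) = ≤-<-trans z≤n c<D VecAll.∷ padding k

module Counting {n : ℕ} (G : BipGraph n) {d : ℕ} (degⱽ≤d : ∀ w → degV G w ≤ d)
                {u v : ℕ} (0<u : 0 < u) (expander : IsExpander G u v)
                {i j : Fin n} (ij : Adj G i j ≡ true) where

  open Coding G i
  open import Data.List.Membership.DecPropositional (_≟_ {n}) using (_∈?_)

  private
    Admissible : ℕ → Set
    Admissible m = (v + u) ^ m ≤ v ^ m * (n * n)

    admissible-0 : Admissible 0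
    admissible-0 = ≤-trans (*-mono-≤ 0<n 0<n) (≤-reflexive (sym (*-identityˡ (n * n))))
      where
      0<n : 0 < n
      0<n = ≤-<-trans z≤n (toℕ<n i)

    -- Cycles found by alternating-cycle have length at most n + n.
    longest : ∃ λ J → Admissible J × (∀ {m} → m ≤ n + n → Admissible m → m ≤ J)
    longest = greatest≤ (λ m → (v + u) ^ m ≤? v ^ m * (n * n)) admissible-0 (n + n)

  J : ℕ
  J = proj₁ longest

  J-admissible : (v + u) ^ J ≤ v ^ J * (n * n)
  J-admissible = proj₁ (proj₂ longest)

  codes : List (Vec ℕ (suc J))
  codes = vecs (upTo (d ∸ 1)) (suc J)

  through : List (Vec (Fin n) n)
  through = filter (λ σ → lookup σ i ≟ j) (perfectMatchings G)

  unswitch : Vec (Fin n) n → Vec ℕ (suc J) → Vec (Fin n) n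
  unswitch σ′ c = tabulate (λ y → lookup σ′ (rotation (i ∷ decode (lookup σ′) i c) ⟨$⟩ˡ y))

  others-length : ∀ {f} → Follows G f → ∀ y → length (others (f y) y) ≤ d ∸ 1
  others-length {f} follows y = subst (_≤ d ∸ 1) (sym (length-elements (λ z → Adj G z (f y) ∧ not ⌊ z ≟ y ⌋)))
    (∸-monoˡ-≤ 1 (≤-trans (countFin-remove (λ z → Adj G z (f y)) (follows y)) (degⱽ≤d (f y))))

  module _ {σ} (pm : IsPerfectMatching G σ ≡ true) {x rest} (σx≡j : lookup σ x ≡ j)
           (uniq : Unique (i ∷ x ∷ rest)) (cycle : Walk (λ y z → Adj G y (lookup σ z) ≡ true) i (x ∷ rest) i)
           (short : length (x ∷ rest) ≤ J) where

    private
      follows : Follows G (lookup σ)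
      follows = proj₁ (isPerfectMatching⁻ G {σ} pm)

      injective : Injective _≡_ _≡_ (lookup σ)
      injective = proj₂ (isPerfectMatching⁻ G {σ} pm)

      ρ : Permutation′ n
      ρ = rotation (i ∷ x ∷ rest)

      ρ-walk : Walk (λ y z → ρ ⟨$⟩ʳ y ≡ z) i (x ∷ rest) i
      ρ-walk = rotation-walk (x ∷ rest) uniq

      σ′ : Fin n → Fin n
      σ′ y = lookup σ (ρ ⟨$⟩ʳ y)

      lookup-switched : ∀ y → lookup (tabulate σ′) y ≡ lookup σ (ρ ⟨$⟩ʳ y)
      lookup-switched = lookup∘tabulate σ′

    switched-follows : Follows G σ′
    switched-follows y with y ∈? (i ∷ x ∷ rest)
    ... | yes y∈ with z , ρy≡z , yz ← Walk-successor (Walk-zip ρ-walk cycle) y∈ =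
      subst (λ z → Adj G y (lookup σ z) ≡ true) (sym ρy≡z) yz
    ... | no y∉ = subst (λ z → Adj G y (lookup σ z) ≡ true) (sym (rotation-fix _ y∉)) (follows y)

    switched-injective : Injective _≡_ _≡_ σ′
    switched-injective = ⟨$⟩ʳ-injective ρ ∘ injective

    switched-∈ : tabulate σ′ ∈ through
    switched-∈ = ∈-filter⁺ (λ σ → lookup σ i ≟ j)
      (∈-perfectMatchings⁺ G (isPerfectMatching⁺ G {σ′} switched-follows switched-injective))
      (trans (lookup-switched i) (trans (cong (lookup σ) (Walk-head ρ-walk)) σx≡j))

    successor-walk : Walk (Successor (lookup (tabulate σ′))) i (x ∷ rest) i
    successor-walk = Walk-map successor (Walk-zip ρ-walk (Unique⇒Walk≢ uniq))
      where
      successor : ∀ {y z} → ρ ⟨$⟩ʳ y ≡ z × y ≢ z → Successor (lookup (tabulate σ′)) y z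
      successor {y} (refl , y≢z) = ∈-elements⁺ _ (∧-true⁺
        (subst (λ w → Adj G (ρ ⟨$⟩ʳ y) w ≡ true) (sym (lookup-switched y)) (follows (ρ ⟨$⟩ʳ y)))
        (cong not (⌊⌋-false⁺ (ρ ⟨$⟩ʳ y ≟ y) (y≢z ∘ sym))))

    code-∈ : encode successor-walk (suc J) ∈ codes
    code-∈ = ∈-vecs (VecAll.map ∈-upTo⁺ (encode-< (others-length follows′) successor-walk (suc J)))
      where
      follows′ : Follows G (lookup (tabulate σ′))
      follows′ y = subst (λ w → Adj G y w ≡ true) (sym (lookup-switched y)) (switched-follows y)

    unswitch-switched : unswitch (tabulate σ′) (encode successor-walk (suc J)) ≡ σ
    unswitch-switched = begin
      unswitch (tabulate σ′) (encode successor-walk (suc J))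
        ≡⟨ cong (λ xs → tabulate (λ y → lookup (tabulate σ′) (rotation (i ∷ xs) ⟨$⟩ˡ y)))
                (decode-encode successor-walk (s≤s short) (All.map (_∘ sym) (AllPairs.head uniq))) ⟩
      tabulate (λ y → lookup (tabulate σ′) (ρ ⟨$⟩ˡ y))
        ≡⟨ tabulate-cong (λ y → trans (lookup-switched (ρ ⟨$⟩ˡ y)) (cong (lookup σ) (inverseʳ ρ))) ⟩
      tabulate (lookup σ)
        ≡⟨ tabulate∘lookup σ ⟩
      σ ∎
      where open ≡-Reasoning

    switched-cover : σ ∈ cartesianProductWith unswitch through codes
    switched-cover = subst (_∈ cartesianProductWith unswitch through codes) unswitch-switched
      (∈-cartesianProductWith⁺ unswitch switched-∈ code-∈)

  perfectMatchings-covered : perfectMatchings G ⊆ through ++ cartesianProductWith unswitch through codes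
  perfectMatchings-covered {σ} σ∈ with lookup σ i ≟ j
  ... | yes σi≡j = ∈-++⁺ˡ (∈-filter⁺ (λ σ → lookup σ i ≟ j) σ∈ σi≡j)
  ... | no  σi≢j = ∈-++⁺ʳ through (cover (∈-perfectMatchings⁻ G σ∈) σi≢j)
    where
    cover : IsPerfectMatching G σ ≡ true → lookup σ i ≢ j → σ ∈ cartesianProductWith unswitch through codes
    cover pm σi≢j = let π = asPermutation G {σ} pm in
      case Alternating.alternating-cycle G π {u} {v} 0<u expander {i} {j} ij σi≢j of λ where
        (rest , uniq , cycle , m , len≤m , m≤2n , admissible) →
          switched-cover pm (inverseʳ π) uniq cycle (≤-trans len≤m (proj₂ (proj₂ longest) m≤2n admissible))

  numPM-bound : numPM G ≤ numPMThrough G i j * (1 + (d ∸ 1) ^ suc J)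
  numPM-bound = begin
    numPM G
      ≤⟨ Unique-⊆⇒length≤ (perfectMatchings-unique G) perfectMatchings-covered ⟩
    length (through ++ cartesianProductWith unswitch through codes)
      ≡⟨ length-++ through ⟩
    length through + length (cartesianProductWith unswitch through codes)
      ≡⟨ cong (length through +_) (length-cartesianProductWith unswitch through codes) ⟩
    length through + length through * length codes
      ≡⟨ cong (λ c → length through + length through * c)
              (trans (length-vecs (upTo (d ∸ 1)) (suc J)) (cong (_^ suc J) (length-upTo (d ∸ 1)))) ⟩
    length through + length through * (d ∸ 1) ^ suc J
      ≡⟨ cong (_+ length through * (d ∸ 1) ^ suc J) (sym (*-identityʳ (length through))) ⟩
    length through * 1 + length through * (d ∸ 1) ^ suc J
      ≡⟨ sym (*-distribˡ-+ (length through) 1 ((d ∸ 1) ^ suc J)) ⟩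
    numPMThrough G i j * (1 + (d ∸ 1) ^ suc J)
      ∎
    where open ≤-Reasoning

theorem1p9 : (n : ℕ) → 2 ≤ n →
    (u v : ℕ) → 1 ≤ u → 1 ≤ v →
    (G : BipGraph n) → (d : ℕ) → MaxDegree G d →
    IsExpander G u v →
    (i j : Fin n) → Adj G i j ≡ true →
    Σ (Vec (Fin n) n) (λ σ → IsPerfectMatching G σ ≡ true) →
    (a b : ℕ) → 1 ≤ b →
    (d ∸ 1) ^ b * v ^ a ≤ (v + u) ^ a →
    numPM G ^ b ≤ d ^ b * numPMThrough G i j ^ b * n ^ (2 * a)
theorem1p9 n _ u v 0<u 0<v G d (degᵁ≤d , degⱽ≤d , _) expander i j ij _ a b _ Dᵇvᵃ≤[v+u]ᵃ = begin
  numPM G ^ b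
    ≤⟨ count-bound b numPM-bound Dᴶᵇ≤n²ᵃ (m^n>0 n {{>-nonZero 0<n}} (2 * a)) ⟩
  (1 + (d ∸ 1)) ^ b * numPMThrough G i j ^ b * n ^ (2 * a)
    ≡⟨ cong (λ d → d ^ b * numPMThrough G i j ^ b * n ^ (2 * a)) (m+[n∸m]≡n 1≤d) ⟩
  d ^ b * numPMThrough G i j ^ b * n ^ (2 * a)
    ∎
  where
  open ≤-Reasoning
  open Counting G degⱽ≤d {u} {v} 0<u expander ij
  0<n : 0 < n
  0<n = ≤-<-trans z≤n (toℕ<n i)
  1≤d : 1 ≤ d
  1≤d = ≤-trans (countFin-pos (Adj G i) ij) (degᵁ≤d i)
  Dᴶᵇ≤n²ᵃ : ((d ∸ 1) ^ J) ^ b ≤ n ^ (2 * a)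
  Dᴶᵇ≤n²ᵃ = subst (((d ∸ 1) ^ J) ^ b ≤_)
    (trans (cong (λ m → (n * m) ^ a) (sym (*-identityʳ n))) (^-*-assoc n 2 a))
    (exponent-transfer a b J 0<v Dᵇvᵃ≤[v+u]ᵃ J-admissible)
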